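{- For every positive integer $n$ and every $p\in(0,1)$, the \textsc{greedy} and \textsc{ranking} algorithms perform equivalently on $G(n,n,p)$: the matching size obtained by \textsc{greedy} on $G(n,n,p)$ has the same distribution as the matching size obtained by \textsc{ranking} on $G(n,n,p)$.
   Context: For a positive integer $n$ and $p\in(0,1)$, $G(n,n,p)$ is the random bipartite graph with a set $I$ of $n$ "bins" and a set $J$ of $n$ "balls", each pair $(i,j)\in I\times J$ being an edge independently with probability $p$; the balls arrive one at a time and the edges of a ball are revealed when it arrives. Online model: the algorithm must immediately and irrevocably match the arriving ball to an unmatched bin or drop it; each bin is matched at most once. The matching size is the number of matched balls. The \textsc{greedy} algorithm: when ball $j$ arrives, let $U(j)$ be the set of unmatched neighboring bins; if $U(j)\ne\emptyset$ match $j$ to a uniformly random bin of $U(j)$, otherwise drop $j$. The \textsc{ranking} algorithm: before any arrivals it picks a uniformly random permutation (ranking) of the bins; each arriving ball is matched to its unmatched neighboring bin of highest rank in the permutation, and dropped if it has no unmatched neighboring bin.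
   Formalization: The edge probability p ranges only over the rationals in $(0,1)$. -}

module Defs where

open import Data.Bool using (Bool; true; false; _∧_; not; if_then_else_)
open import Data.Nat as ℕ using (ℕ; zero; suc)
open import Data.Fin using (Fin)
open import Data.Integer using (+_)
open import Data.Rational using (ℚ; 0ℚ; 1ℚ; _+_; _*_; _-_; _/_)
open import Data.List as List using (List; []; _∷_; map; concatMap; filter; length; foldr)
open import Data.Vec as Vec using (Vec; []; _∷_; lookup; _[_]≔_; replicate)
open import Data.Product using (_×_; _,_)
open import Relation.Nullary.Decidable using (does)
open import Relation.Unary using (Pred)

Dist : Set → Set
Dist A = List (ℚ × A)

return : {A : Set} → A → Dist A
return a = (1ℚ , a) ∷ []

_>>=_ : {A B : Set} → Dist A → (A → Dist B) → Dist B
d >>= f = concatMap (λ { (w , a) → map (λ { (v , b) → (w * v , b) }) (f a) }) d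

uniform : {A : Set} → List A → Dist A
uniform []       = []
uniform (x ∷ xs) = map (λ a → ((+ 1) / suc (length xs) , a)) (x ∷ xs)

bernoulli : ℚ → Dist Bool
bernoulli p = (p , true) ∷ (1ℚ - p , false) ∷ []

probEq : Dist ℕ → ℕ → ℚ
probEq d k = foldr (λ { (w , a) acc → (if does (a ℕ.≟ k) then w else 0ℚ) + acc }) 0ℚ d

sequenceV : {A : Set} {m : ℕ} → Vec (Dist A) m → Dist (Vec A m)
sequenceV []       = return []
sequenceV (d ∷ ds) = d >>= λ a → sequenceV ds >>= λ as → return (a ∷ as)

-- The random bipartite graph G(n,n,p).
-- A graph is a vector of n balls (in arrival order); ball j is given by
-- its row: a vector over the n bins, entry i = true iff (i,j) is an edge.

Graph : ℕ → Set
Graph n = Vec (Vec Bool n) n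

randomGraph : (n : ℕ) → ℚ → Dist (Graph n)
randomGraph n p = sequenceV (replicate n (sequenceV (replicate n (bernoulli p))))

-- matched bins: entry i = true iff bin i is already matched
Matched : ℕ → Set
Matched n = Vec Bool n

unmatchedNbrs : {n : ℕ} → Vec Bool n → Matched n → List (Fin n)
unmatchedNbrs {n} r m =
  filter (λ i → Data.Bool._≟_ (lookup r i ∧ not (lookup m i)) true)
         (Vec.toList (Vec.allFin n))
  where import Data.Bool

greedyRun : {n k : ℕ} → Vec (Vec Bool n) k → Matched n → Dist ℕ
greedyRun []       m = return 0
greedyRun (r ∷ rs) m with unmatchedNbrs r m
... | []     = greedyRun rs m
... | i ∷ is = uniform (i ∷ is) >>= λ b →
               greedyRun rs (m [ b ]≔ true) >>= λ s → return (suc s)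

greedy : {n : ℕ} → Graph n → Dist ℕ
greedy {n} g = greedyRun g (replicate n false)

-- RANKING: a ranking is a permutation of the bins, listed from highest
-- to lowest rank; each ball is matched to its highest-ranked unmatched
-- neighbouring bin, or dropped if there is none.

insertions : {A : Set} → A → List A → List (List A)
insertions x []       = (x ∷ []) ∷ []
insertions x (y ∷ ys) = (x ∷ y ∷ ys) ∷ map (y ∷_) (insertions x ys)

-- all permutations of a list (each permutation of distinct entries exactly once)
permutations : {A : Set} → List A → List (List A)
permutations []       = [] ∷ []
permutations (x ∷ xs) = concatMap (insertions x) (permutations xs)

firstAvailable : {n : ℕ} → List (Fin n) → Vec Bool n → Matched n → List (Fin n)
firstAvailable []       r m = []
firstAvailable (i ∷ σ)  r m =
  if lookup r i ∧ not (lookup m i) then i ∷ [] else firstAvailable σ r m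

rankingRun : {n k : ℕ} → List (Fin n) → Vec (Vec Bool n) k → Matched n → ℕ
rankingRun σ []       m = 0
rankingRun σ (r ∷ rs) m with firstAvailable σ r m
... | []    = rankingRun σ rs m
... | i ∷ _ = suc (rankingRun σ rs (m [ i ]≔ true))

ranking : {n : ℕ} → Graph n → Dist ℕ
ranking {n} g =
  uniform (permutations (Vec.toList (Vec.allFin n))) >>= λ σ →
  return (rankingRun σ g (replicate n false))

greedyOnG : (n : ℕ) → ℚ → Dist ℕ
greedyOnG n p = randomGraph n p >>= greedy

rankingOnG : (n : ℕ) → ℚ → Dist ℕ
rankingOnG n p = randomGraph n p >>= ranking

-- When a ball arrives while c bins are unmatched, its edges to these bins are fresh
-- independent p-coins, so it has an unmatched neighbour with probability 1 - (1 - p)^c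
-- whatever the matched set is, and both algorithms then match it to one of those
-- neighbours, leaving c - 1 unmatched bins.  Hence for greedy, and for ranking with any
-- fixed ranking, the expectation of f (matching size) over k further balls depends only
-- on k and c and obeys the same recursion (sizeExpectation).  Laws on ℕ are compared
-- through these expectations, probEq being the expectation of an indicator.

{-# OPTIONS --safe #-}
module Submission where

open import Defs
open import Data.Nat using (ℕ; _≥_)
open import Data.Rational using (ℚ; 0ℚ; 1ℚ; _<_)
open import Relation.Binary.PropositionalEquality using (_≡_)

open import Algebra.Bundles using (Ring)
open import Data.Bool using (Bool; true; false; _∧_; _∨_; not; if_then_else_)
open import Data.Bool.Properties using (¬-not; ∨-zeroʳ) renaming (_≟_ to _≟ᵇ_)
open import Data.Fin using (Fin; zero; suc)
open import Data.Integer using (+_; 1ℤ)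
open import Data.Integer.Solver using (module +-*-Solver)
open import Data.List using (List; []; _∷_; _++_; map; length)
open import Data.List.Membership.Propositional using (_∈_; find)
open import Data.List.Membership.Propositional.Properties
  using (∈-map⁻; map∷⁻; ∈-concatMap⁻; ∈-filter⁺; ∈-filter⁻)
open import Data.List.Relation.Binary.Subset.Propositional using (_⊆_)
open import Data.List.Relation.Unary.Any using (here; there)
open import Data.Nat as ℕ using (zero; suc; pred)
open import Data.Product using (_×_; _,_; ∃; proj₂)
open import Data.Rational as ℚ using (_+_; _*_; _-_; _/_; 1/_; toℚᵘ)
open import Data.Rational.Literals using (fromℤ)
open import Data.Rational.Properties
open import Data.Rational.Solver using (module +-*-Solver)
open import Data.Rational.Unnormalised as ℚᵘ using (mkℚᵘ; 1ℚᵘ; *≡*) renaming (_≃_ to _≃ᵘ_)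
import Data.Rational.Unnormalised.Properties as ℚᵘ
open import Data.Vec as Vec using (Vec; []; _∷_; lookup; _[_]≔_; replicate)
open import Data.Vec.Membership.Propositional.Properties using (∈-allFin⁺; ∈-toList⁺)
open import Function using (_∘_; id; case_of_)
open import Relation.Binary.PropositionalEquality
  using (refl; sym; trans; cong; cong₂; subst; module ≡-Reasoning)
open import Relation.Nullary.Decidable using (does)
open import Relation.Unary using (Decidable)

open import Algebra.Definitions.RawSemiring ℚ.+-*-rawSemiring using (_^_)
open import Algebra.Properties.Semiring.Mult (Ring.semiring +-*-ring)
  using (×-assoc-*) renaming (_×_ to _times_)

private
  variable
    A B : Set
    n : ℕ

expect : Dist A → (A → ℚ) → ℚ
expect []            f = 0ℚ
expect ((w , a) ∷ d) f = w * f a + expect d f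

expect-cong-∈ : (d : Dist A) {f g : A → ℚ} →
                (∀ {w a} → (w , a) ∈ d → f a ≡ g a) → expect d f ≡ expect d g
expect-cong-∈ []            f≗g = refl
expect-cong-∈ ((w , a) ∷ d) f≗g =
  cong₂ (λ x y → w * x + y) (f≗g (here refl)) (expect-cong-∈ d (f≗g ∘ there))

expect-cong : (d : Dist A) {f g : A → ℚ} → (∀ a → f a ≡ g a) → expect d f ≡ expect d g
expect-cong d f≗g = expect-cong-∈ d (λ {_} {a} _ → f≗g a)

expect-++ : (d e : Dist A) (f : A → ℚ) → expect (d ++ e) f ≡ expect d f + expect e f
expect-++ []            e f = sym (+-identityˡ _)
expect-++ ((w , a) ∷ d) e f =
  trans (cong (λ x → w * f a + x) (expect-++ d e f)) (sym (+-assoc (w * f a) _ _))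

-- The reweighting inside _>>=_ is a pattern lambda, so it is characterised by its action.
expect-map-scale : (w : ℚ) (h : ℚ × B → ℚ × B) → (∀ v b → h (v , b) ≡ (w * v , b)) →
                   (d : Dist B) (f : B → ℚ) → expect (map h d) f ≡ w * expect d f
expect-map-scale w h h-scales []            f = sym (*-zeroʳ w)
expect-map-scale w h h-scales ((v , b) ∷ d) f rewrite h-scales v b =
  trans (cong₂ _+_ (*-assoc w v (f b)) (expect-map-scale w h h-scales d f))
        (sym (*-distribˡ-+ w _ _))

expect->>= : (d : Dist A) (g : A → Dist B) (f : B → ℚ) →
             expect (d >>= g) f ≡ expect d (λ a → expect (g a) f)
expect->>= []            g f = refl
expect->>= ((w , a) ∷ d) g f =
  trans (expect-++ (map _ (g a)) (d >>= g) f)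
        (cong₂ _+_ (expect-map-scale w _ (λ _ _ → refl) (g a) f) (expect->>= d g f))

expect-return : (a : A) (f : A → ℚ) → expect (return a) f ≡ f a
expect-return a f = trans (+-identityʳ _) (*-identityˡ _)

expect->>=-return : (d : Dist A) (g : A → B) (f : B → ℚ) →
                    expect (d >>= λ a → return (g a)) f ≡ expect d (f ∘ g)
expect->>=-return d g f =
  trans (expect->>= d (λ a → return (g a)) f) (expect-cong d λ a → expect-return (g a) f)

expect->>=-suc : (d : Dist A) (g : A → Dist ℕ) (f : ℕ → ℚ) →
                 expect (d >>= λ a → g a >>= λ s → return (suc s)) f
                 ≡ expect d (λ a → expect (g a) (f ∘ suc))
expect->>=-suc d g f =
  trans (expect->>= d (λ a → g a >>= λ s → return (suc s)) f)
        (expect-cong d λ a → expect->>=-return (g a) suc f)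

expect-zero : (d : Dist A) → expect d (λ _ → 0ℚ) ≡ 0ℚ
expect-zero []            = refl
expect-zero ((w , a) ∷ d) = trans (cong₂ _+_ (*-zeroʳ w) (expect-zero d)) (+-identityʳ 0ℚ)

expect-linear : (d : Dist A) (w : ℚ) (g h : A → ℚ) →
                expect d (λ a → w * g a + h a) ≡ w * expect d g + expect d h
expect-linear []            w g h = sym (trans (+-identityʳ _) (*-zeroʳ w))
expect-linear ((v , a) ∷ d) w g h =
  trans (cong (λ x → v * (w * g a + h a) + x) (expect-linear d w g h))
        (solve 6 (λ v w x y z t → v :* (w :* x :+ y) :+ (w :* z :+ t)
                                 := w :* (v :* x :+ z) :+ (v :* y :+ t))
               refl v w (g a) (h a) (expect d g) (expect d h))
  where open Data.Rational.Solver.+-*-Solver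

expect-swap : (d : Dist A) (e : Dist B) (h : A → B → ℚ) →
              expect d (λ a → expect e (h a)) ≡ expect e (λ b → expect d (λ a → h a b))
expect-swap []            e h = sym (expect-zero e)
expect-swap ((w , a) ∷ d) e h =
  trans (cong (λ x → w * expect e (h a) + x) (expect-swap d e h))
        (sym (expect-linear e w (h a) (λ b → expect d (λ a′ → h a′ b))))

expect-sequenceV-∷ : {k : ℕ} (d : Dist A) (ds : Vec (Dist A) k) (f : Vec A (suc k) → ℚ) →
                     expect (sequenceV (d ∷ ds)) f
                     ≡ expect d (λ a → expect (sequenceV ds) (λ as → f (a ∷ as)))
expect-sequenceV-∷ d ds f =
  trans (expect->>= d (λ a → sequenceV ds >>= λ as → return (a ∷ as)) f)
        (expect-cong d λ a → expect->>=-return (sequenceV ds) (a ∷_) f)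

indicator : ℕ → ℕ → ℚ
indicator k a = if does (a ℕ.≟ k) then 1ℚ else 0ℚ

probEq≡expect : (d : Dist ℕ) (k : ℕ) → probEq d k ≡ expect d (indicator k)
probEq≡expect []            k = refl
probEq≡expect ((w , a) ∷ d) k = cong₂ _+_ (weight (does (a ℕ.≟ k))) (probEq≡expect d k)
  where
  weight : (b : Bool) → (if b then w else 0ℚ) ≡ w * (if b then 1ℚ else 0ℚ)
  weight true  = sym (*-identityʳ w)
  weight false = sym (*-zeroʳ w)

Normalised : Dist A → Set
Normalised d = ∀ h → expect d (λ _ → h) ≡ h

return-normalised : (a : A) → Normalised (return a)
return-normalised a h = expect-return a (λ _ → h)

>>=-normalised : (d : Dist A) (g : A → Dist B) →
                 Normalised d → (∀ a → Normalised (g a)) → Normalised (d >>= g)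
>>=-normalised d g d-norm g-norm h =
  trans (expect->>= d g (λ _ → h)) (trans (expect-cong d (λ a → g-norm a h)) (d-norm h))

sequenceV-replicate-normalised : {d : Dist A} → Normalised d → (k : ℕ) →
                                 Normalised (sequenceV (replicate k d))
sequenceV-replicate-normalised {A = A} d-norm zero = return-normalised {A = Vec A 0} []
sequenceV-replicate-normalised {d = d} d-norm (suc k) =
  >>=-normalised d _ d-norm λ a →
    >>=-normalised (sequenceV (replicate k d)) (λ as → return (a ∷ as))
                   (sequenceV-replicate-normalised d-norm k) (λ as → return-normalised (a ∷ as))

bernoulli-normalised : (p : ℚ) → Normalised (bernoulli p)
bernoulli-normalised p h =
  solve 2 (λ p h → p :* h :+ ((con 1ℚ :- p) :* h :+ con 0ℚ) := h) refl p h
  where open Data.Rational.Solver.+-*-Solver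

toℚᵘ-n×1 : ∀ n → toℚᵘ (n times 1ℚ) ≃ᵘ mkℚᵘ (+ n) 0
toℚᵘ-n×1 zero    = *≡* refl
toℚᵘ-n×1 (suc n) = begin
  toℚᵘ (1ℚ + n times 1ℚ)      ≈⟨ toℚᵘ-homo-+ 1ℚ (n times 1ℚ) ⟩
  1ℚᵘ ℚᵘ.+ toℚᵘ (n times 1ℚ)  ≈⟨ ℚᵘ.+-congʳ 1ℚᵘ (toℚᵘ-n×1 n) ⟩
  1ℚᵘ ℚᵘ.+ mkℚᵘ (+ n) 0       ≈⟨ *≡* (solve 1 (λ n → (con 1ℤ :* con 1ℤ :+ n :* con 1ℤ) :* con 1ℤ
                                                     := (con 1ℤ :+ n) :* (con 1ℤ :* con 1ℤ))
                                             refl (+ n)) ⟩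
  mkℚᵘ (+ suc n) 0            ∎
  where
  open ℚᵘ.≃-Reasoning
  open Data.Integer.Solver.+-*-Solver

[1+n]×1/[1+n]≡1 : ∀ n → suc n times ((+ 1) / suc n) ≡ 1ℚ
[1+n]×1/[1+n]≡1 n = begin
  suc n times w           ≡⟨ cong (suc n times_) (*-identityˡ w) ⟨
  suc n times (1ℚ * w)    ≡⟨ ×-assoc-* (suc n) 1ℚ w ⟨
  -- w is the normalisation of 1/ q, which is already in normal form.
  (suc n times 1ℚ) * w    ≡⟨ cong₂ _*_ (toℚᵘ-injective {y = q} (toℚᵘ-n×1 (suc n))) (↥p/↧p≡p (1/ q)) ⟩
  q * 1/ q                ≡⟨ *-inverseʳ q ⟩
  1ℚ                      ∎
  where
  open ≡-Reasoning
  q w : ℚ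
  q = fromℤ (+ suc n)
  w = (+ 1) / suc n

expect-constantWeight : (w h : ℚ) (xs : List A) →
                        expect (map (w ,_) xs) (λ _ → h) ≡ length xs times (w * h)
expect-constantWeight w h []       = refl
expect-constantWeight w h (x ∷ xs) = cong (λ x → w * h + x) (expect-constantWeight w h xs)

uniform-normalised : (x : A) (xs : List A) → Normalised (uniform (x ∷ xs))
uniform-normalised x xs h = begin
  expect (uniform (x ∷ xs)) (λ _ → h)  ≡⟨ expect-constantWeight w h (x ∷ xs) ⟩
  suc (length xs) times (w * h)        ≡⟨ ×-assoc-* (suc (length xs)) w h ⟨
  (suc (length xs) times w) * h        ≡⟨ cong (_* h) ([1+n]×1/[1+n]≡1 (length xs)) ⟩
  1ℚ * h                               ≡⟨ *-identityˡ h ⟩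
  h                                    ∎
  where
  open ≡-Reasoning
  w : ℚ
  w = (+ 1) / suc (length xs)

∈-uniform⁻ : (xs : List A) {w : ℚ} {a : A} → (w , a) ∈ uniform xs → a ∈ xs
∈-uniform⁻ (x ∷ xs) wa∈ with ∈-map⁻ _ wa∈
... | _ , a∈ , refl = a∈

free : Vec Bool n → Matched n → Fin n → Bool
free r m i = lookup r i ∧ not (lookup m i)

hasFree : Vec Bool n → Matched n → Bool
hasFree []      []      = false
hasFree (b ∷ r) (c ∷ m) = (b ∧ not c) ∨ hasFree r m

unmatchedCount : Matched n → ℕ
unmatchedCount []          = 0
unmatchedCount (true  ∷ m) = unmatchedCount m
unmatchedCount (false ∷ m) = suc (unmatchedCount m)

hasFree-true : (r : Vec Bool n) (m : Matched n) {i : Fin n} → free r m i ≡ true → hasFree r m ≡ true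
hasFree-true (b ∷ r) (c ∷ m) {zero}  fi rewrite fi = refl
hasFree-true (b ∷ r) (c ∷ m) {suc i} fi rewrite hasFree-true r m fi = ∨-zeroʳ (b ∧ not c)

hasFree-false : (r : Vec Bool n) (m : Matched n) → (∀ i → free r m i ≡ false) → hasFree r m ≡ false
hasFree-false []      []      none = refl
hasFree-false (b ∷ r) (c ∷ m) none rewrite none zero = hasFree-false r m (none ∘ suc)

free⇒unmatched : (r : Vec Bool n) (m : Matched n) (i : Fin n) → free r m i ≡ true → lookup m i ≡ false
free⇒unmatched r m i fi with lookup r i | lookup m i
... | true | false = refl

unmatchedCount-match : (m : Matched n) (i : Fin n) → lookup m i ≡ false →
                       unmatchedCount m ≡ suc (unmatchedCount (m [ i ]≔ true))
unmatchedCount-match (false ∷ m) zero    _  = refl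
unmatchedCount-match (true  ∷ m) (suc i) mi = unmatchedCount-match m i mi
unmatchedCount-match (false ∷ m) (suc i) mi = cong suc (unmatchedCount-match m i mi)

unmatchedCount-replicate : ∀ n → unmatchedCount (replicate n false) ≡ n
unmatchedCount-replicate zero    = refl
unmatchedCount-replicate (suc n) = cong suc (unmatchedCount-replicate n)

private
  free? : (r : Vec Bool n) (m : Matched n) → Decidable (λ i → free r m i ≡ true)
  free? r m i = free r m i ≟ᵇ true

∈-unmatchedNbrs⁻ : (r : Vec Bool n) (m : Matched n) {i : Fin n} →
                   i ∈ unmatchedNbrs r m → free r m i ≡ true
∈-unmatchedNbrs⁻ r m i∈ = proj₂ (∈-filter⁻ (free? r m) {xs = Vec.toList (Vec.allFin _)} i∈)

unmatchedNbrs-[] : (r : Vec Bool n) (m : Matched n) → unmatchedNbrs r m ≡ [] → hasFree r m ≡ false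
unmatchedNbrs-[] r m none = hasFree-false r m λ i → ¬-not λ fi →
  case subst (i ∈_) none (∈-filter⁺ (free? r m) (∈-toList⁺ (∈-allFin⁺ i)) fi) of λ ()

firstAvailable-∷ : (σ : List (Fin n)) (r : Vec Bool n) (m : Matched n) {i : Fin n} {is : List (Fin n)} →
                   firstAvailable σ r m ≡ i ∷ is → free r m i ≡ true
firstAvailable-∷ (j ∷ σ) r m found with lookup r j ∧ not (lookup m j) in fj
firstAvailable-∷ (j ∷ σ) r m refl  | true  = fj
firstAvailable-∷ (j ∷ σ) r m found | false = firstAvailable-∷ σ r m found

firstAvailable-[] : (σ : List (Fin n)) (r : Vec Bool n) (m : Matched n) {i : Fin n} →
                    firstAvailable σ r m ≡ [] → i ∈ σ → free r m i ≡ false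
firstAvailable-[] (j ∷ σ) r m none i∈ with lookup r j ∧ not (lookup m j) in fj
firstAvailable-[] (j ∷ σ) r m ()   _           | true
firstAvailable-[] (j ∷ σ) r m none (here refl)  | false = fj
firstAvailable-[] (j ∷ σ) r m none (there i∈σ) | false = firstAvailable-[] σ r m none i∈σ

randomRow : ℚ → (n : ℕ) → Dist (Vec Bool n)
randomRow p n = sequenceV (replicate n (bernoulli p))

randomRows : ℚ → (n k : ℕ) → Dist (Vec (Vec Bool n) k)
randomRows p n k = sequenceV (replicate k (randomRow p n))

randomRow-normalised : (p : ℚ) (n : ℕ) → Normalised (randomRow p n)
randomRow-normalised p = sequenceV-replicate-normalised (bernoulli-normalised p)

expect-randomRow-suc : (p : ℚ) (n : ℕ) (g : Vec Bool (suc n) → ℚ) →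
                       expect (randomRow p (suc n)) g
                       ≡ p * expect (randomRow p n) (g ∘ (true ∷_))
                         + (1ℚ - p) * expect (randomRow p n) (g ∘ (false ∷_))
expect-randomRow-suc p n g =
  trans (expect-sequenceV-∷ (bernoulli p) (replicate n (bernoulli p)) g)
        (cong (λ x → p * expect (randomRow p n) (g ∘ (true ∷_)) + x) (+-identityʳ _))

expect-hasFree : (p : ℚ) (n : ℕ) (m : Matched n) (x y : ℚ) →
                 expect (randomRow p n) (λ r → if hasFree r m then x else y)
                 ≡ x + (1ℚ - p) ^ unmatchedCount m * (y - x)
expect-hasFree p zero    []          x y =
  trans (expect-return Vec.[] (λ r → if hasFree r [] then x else y))
        (solve 2 (λ x y → y := x :+ con 1ℚ :* (y :- x)) refl x y)
  where open Data.Rational.Solver.+-*-Solver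
expect-hasFree p (suc n) (true ∷ m)  x y =
  trans (expect-randomRow-suc p n _)
        (trans (cong₂ (λ a b → p * a + (1ℚ - p) * b)
                      (expect-hasFree p n m x y) (expect-hasFree p n m x y))
               (solve 2 (λ p z → p :* z :+ (con 1ℚ :- p) :* z := z) refl p _))
  where open Data.Rational.Solver.+-*-Solver
expect-hasFree p (suc n) (false ∷ m) x y =
  trans (expect-randomRow-suc p n _)
        (trans (cong₂ (λ a b → p * a + (1ℚ - p) * b)
                      (randomRow-normalised p n x) (expect-hasFree p n m x y))
               (solve 4 (λ p x y q → p :* x :+ (con 1ℚ :- p) :* (x :+ q :* (y :- x))
                                     := x :+ ((con 1ℚ :- p) :* q) :* (y :- x))
                      refl p x y ((1ℚ - p) ^ unmatchedCount m)))
  where open Data.Rational.Solver.+-*-Solver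

-- pred 0 = 0 is harmless: for c = 0 the weight 1 - (1 - p)^0 of ifMatched vanishes.
sizeExpectation : ℚ → (k c : ℕ) → (ℕ → ℚ) → ℚ
sizeExpectation p zero    c f = f 0
sizeExpectation p (suc k) c f = ifMatched + (1ℚ - p) ^ c * (ifDropped - ifMatched)
  where
  ifMatched ifDropped : ℚ
  ifMatched = sizeExpectation p k (pred c) (f ∘ suc)
  ifDropped = sizeExpectation p k c f

expect-randomRows-suc : (p : ℚ) {n k : ℕ} (m : Matched n) (f : ℕ → ℚ)
                        (g : Vec (Vec Bool n) (suc k) → ℚ) →
  (∀ r → expect (randomRows p n k) (λ rs → g (r ∷ rs))
         ≡ (if hasFree r m then sizeExpectation p k (pred (unmatchedCount m)) (f ∘ suc)
                           else sizeExpectation p k (unmatchedCount m) f)) →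
  expect (randomRows p n (suc k)) g ≡ sizeExpectation p (suc k) (unmatchedCount m) f
expect-randomRows-suc p {n} {k} m f g nextBall =
  trans (expect-sequenceV-∷ (randomRow p n) (replicate k (randomRow p n)) g)
        (trans (expect-cong (randomRow p n) nextBall) (expect-hasFree p n m _ _))

sizeExpectation-match : (p : ℚ) (k : ℕ) (m : Matched n) (i : Fin n) (f : ℕ → ℚ) →
                        lookup m i ≡ false →
                        sizeExpectation p k (unmatchedCount (m [ i ]≔ true)) f
                        ≡ sizeExpectation p k (pred (unmatchedCount m)) f
sizeExpectation-match p k m i f mi =
  cong (λ c → sizeExpectation p k c f) (cong pred (sym (unmatchedCount-match m i mi)))

expect-greedyRun : (p : ℚ) {n : ℕ} (k : ℕ) (m : Matched n) (f : ℕ → ℚ) →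
                   expect (randomRows p n k) (λ rs → expect (greedyRun rs m) f)
                   ≡ sizeExpectation p k (unmatchedCount m) f
expect-greedyRun p zero    m f =
  trans (expect-return Vec.[] (λ rs → expect (greedyRun rs m) f)) (expect-return 0 f)
expect-greedyRun p {n} (suc k) m f = expect-randomRows-suc p m f _ nextBall
  where
  rows : Dist (Vec (Vec Bool n) k)
  rows = randomRows p n k
  ifMatched ifDropped : ℚ
  ifMatched = sizeExpectation p k (pred (unmatchedCount m)) (f ∘ suc)
  ifDropped = sizeExpectation p k (unmatchedCount m) f
  nextBall : ∀ r → expect rows (λ rs → expect (greedyRun (r ∷ rs) m) f)
                   ≡ (if hasFree r m then ifMatched else ifDropped)
  nextBall r with unmatchedNbrs r m in nbrs
  ... | [] rewrite unmatchedNbrs-[] r m nbrs = expect-greedyRun p k m f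
  ... | i ∷ is rewrite hasFree-true r m (∈-unmatchedNbrs⁻ r m (subst (i ∈_) (sym nbrs) (here refl))) = begin
    expect rows (λ rs → expect (U >>= λ b → greedyRun rs (m [ b ]≔ true) >>= λ s → return (suc s)) f)
      ≡⟨ expect-cong rows (λ rs → expect->>=-suc U (λ b → greedyRun rs (m [ b ]≔ true)) f) ⟩
    expect rows (λ rs → expect U (λ b → expect (greedyRun rs (m [ b ]≔ true)) (f ∘ suc)))
      ≡⟨ expect-swap rows U _ ⟩
    expect U (λ b → expect rows (λ rs → expect (greedyRun rs (m [ b ]≔ true)) (f ∘ suc)))
      ≡⟨ expect-cong-∈ U (λ {_} {b} b∈ → matched b (∈-uniform⁻ (i ∷ is) b∈)) ⟩
    expect U (λ _ → ifMatched)
      ≡⟨ uniform-normalised i is ifMatched ⟩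
    ifMatched ∎
    where
    open ≡-Reasoning
    U : Dist (Fin n)
    U = uniform (i ∷ is)
    isFree : ∀ {b} → b ∈ i ∷ is → free r m b ≡ true
    isFree b∈ = ∈-unmatchedNbrs⁻ r m (subst (_ ∈_) (sym nbrs) b∈)
    matched : ∀ b → b ∈ i ∷ is →
              expect rows (λ rs → expect (greedyRun rs (m [ b ]≔ true)) (f ∘ suc)) ≡ ifMatched
    matched b b∈ = trans (expect-greedyRun p k (m [ b ]≔ true) (f ∘ suc))
                         (sizeExpectation-match p k m b (f ∘ suc) (free⇒unmatched r m b (isFree b∈)))

expect-rankingRun : (p : ℚ) {n : ℕ} (σ : List (Fin n)) → (∀ i → i ∈ σ) →
                    (k : ℕ) (m : Matched n) (f : ℕ → ℚ) →
                    expect (randomRows p n k) (λ rs → f (rankingRun σ rs m))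
                    ≡ sizeExpectation p k (unmatchedCount m) f
expect-rankingRun p σ σ-complete zero    m f = expect-return Vec.[] (λ rs → f (rankingRun σ rs m))
expect-rankingRun p {n} σ σ-complete (suc k) m f = expect-randomRows-suc p m f _ nextBall
  where
  ifMatched ifDropped : ℚ
  ifMatched = sizeExpectation p k (pred (unmatchedCount m)) (f ∘ suc)
  ifDropped = sizeExpectation p k (unmatchedCount m) f
  nextBall : ∀ r → expect (randomRows p n k) (λ rs → f (rankingRun σ (r ∷ rs) m))
                   ≡ (if hasFree r m then ifMatched else ifDropped)
  nextBall r with firstAvailable σ r m in first
  ... | [] rewrite hasFree-false r m (λ i → firstAvailable-[] σ r m first (σ-complete i)) =
    expect-rankingRun p σ σ-complete k m f
  ... | i ∷ _ rewrite hasFree-true r m (firstAvailable-∷ σ r m first) =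
    trans (expect-rankingRun p σ σ-complete k (m [ i ]≔ true) (f ∘ suc))
          (sizeExpectation-match p k m i (f ∘ suc)
            (free⇒unmatched r m i (firstAvailable-∷ σ r m first)))

insertions-head : (x : A) (xs : List A) → ∃ λ rest → insertions x xs ≡ (x ∷ xs) ∷ rest
insertions-head x []      = _ , refl
insertions-head x (_ ∷ _) = _ , refl

permutations-head : (xs : List A) → ∃ λ rest → permutations xs ≡ xs ∷ rest
permutations-head []       = _ , refl
permutations-head (x ∷ xs) with permutations xs | permutations-head xs
... | .(xs ∷ rest) | rest , refl with insertions x xs | insertions-head x xs
... | .((x ∷ xs) ∷ rest′) | rest′ , refl = _ , refl

uniform-permutations-normalised : (xs : List A) → Normalised (uniform (permutations xs))
uniform-permutations-normalised xs with permutations xs | permutations-head xs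
... | .(xs ∷ rest) | rest , refl = uniform-normalised xs rest

∈-insertions⁻ : {x : A} (xs : List A) {ys : List A} → ys ∈ insertions x xs → x ∷ xs ⊆ ys
∈-insertions⁻ []       (here refl) = id
∈-insertions⁻ (_ ∷ _)  (here refl) = id
∈-insertions⁻ (y ∷ xs) (there ys∈) with map∷⁻ ys∈
... | zs , zs∈ , refl = λ where
  (here refl)          → there (∈-insertions⁻ xs zs∈ (here refl))
  (there (here refl))  → here refl
  (there (there z∈))   → there (∈-insertions⁻ xs zs∈ (there z∈))

∈-permutations⁻ : (xs : List A) {ys : List A} → ys ∈ permutations xs → xs ⊆ ys
∈-permutations⁻ (x ∷ xs) ys∈ with find (∈-concatMap⁻ (insertions x) {xs = permutations xs} ys∈)
... | zs , zs∈ , ys∈′ = λ where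
  (here refl) → ∈-insertions⁻ zs ys∈′ (here refl)
  (there z∈)  → ∈-insertions⁻ zs ys∈′ (there (∈-permutations⁻ xs zs∈ z∈))

expect-greedyOnG : (n : ℕ) (p : ℚ) (f : ℕ → ℚ) →
                   expect (greedyOnG n p) f ≡ sizeExpectation p n n f
expect-greedyOnG n p f = begin
  expect (randomGraph n p >>= greedy) f
    ≡⟨ expect->>= (randomGraph n p) greedy f ⟩
  expect (randomGraph n p) (λ g → expect (greedyRun g unmatched) f)
    ≡⟨ expect-greedyRun p n unmatched f ⟩
  sizeExpectation p n (unmatchedCount unmatched) f
    ≡⟨ cong (λ c → sizeExpectation p n c f) (unmatchedCount-replicate n) ⟩
  sizeExpectation p n n f
    ∎
  where
  open ≡-Reasoning
  unmatched : Matched n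
  unmatched = replicate n false

expect-rankingOnG : (n : ℕ) (p : ℚ) (f : ℕ → ℚ) →
                    expect (rankingOnG n p) f ≡ sizeExpectation p n n f
expect-rankingOnG n p f = begin
  expect (randomGraph n p >>= ranking) f
    ≡⟨ expect->>= (randomGraph n p) ranking f ⟩
  expect (randomGraph n p) (λ g → expect (ranking g) f)
    ≡⟨ expect-cong (randomGraph n p) (λ g → expect->>=-return rankings (λ σ → rankingRun σ g unmatched) f) ⟩
  expect (randomGraph n p) (λ g → expect rankings (λ σ → f (rankingRun σ g unmatched)))
    ≡⟨ expect-swap (randomGraph n p) rankings _ ⟩
  expect rankings (λ σ → expect (randomGraph n p) (λ g → f (rankingRun σ g unmatched)))
    ≡⟨ expect-cong-∈ rankings (λ σ∈ → expect-rankingRun p _ (complete σ∈) n unmatched f) ⟩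
  expect rankings (λ _ → sizeExpectation p n (unmatchedCount unmatched) f)
    ≡⟨ uniform-permutations-normalised bins _ ⟩
  sizeExpectation p n (unmatchedCount unmatched) f
    ≡⟨ cong (λ c → sizeExpectation p n c f) (unmatchedCount-replicate n) ⟩
  sizeExpectation p n n f
    ∎
  where
  open ≡-Reasoning
  unmatched : Matched n
  unmatched = replicate n false
  bins : List (Fin n)
  bins = Vec.toList (Vec.allFin n)
  rankings : Dist (List (Fin n))
  rankings = uniform (permutations bins)
  complete : ∀ {w σ} → (w , σ) ∈ rankings → ∀ i → i ∈ σ
  complete σ∈ i = ∈-permutations⁻ bins (∈-uniform⁻ (permutations bins) σ∈) (∈-toList⁺ (∈-allFin⁺ i))

lemma4 : (n : ℕ) → n ≥ 1 → (p : ℚ) → 0ℚ < p → p < 1ℚ →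
           (k : ℕ) → probEq (greedyOnG n p) k ≡ probEq (rankingOnG n p) k
lemma4 n _ p _ _ k = begin
  probEq (greedyOnG n p) k                  ≡⟨ probEq≡expect (greedyOnG n p) k ⟩
  expect (greedyOnG n p) (indicator k)      ≡⟨ expect-greedyOnG n p (indicator k) ⟩
  sizeExpectation p n n (indicator k)       ≡⟨ expect-rankingOnG n p (indicator k) ⟨
  expect (rankingOnG n p) (indicator k)     ≡⟨ probEq≡expect (rankingOnG n p) k ⟨
  probEq (rankingOnG n p) k                 ∎
  where open ≡-Reasoning
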